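{- Let $H$ be a graph, $K$ a clique of $H$, and $x$ a vertex of $H$ not in $K$ that is adjacent to every vertex of $K$; suppose that all vertices of $K$ have the same closed neighborhood in $H-x$. For $0\le i\le |K|$, let $H_i$ be the graph obtained from $H$ by removing $i$ of the edges between $K$ and $x$. Then \[ (i-j)X_{H_k}+(j-k)X_{H_i}+(k-i)X_{H_j}=0\quad\text{for any } 0\le i\le j\le k\le |K|. \]
   Context: All graphs are finite simple graphs; $X_G=\sum_{\kappa}\prod_{v\in V(G)}x_{\kappa(v)}$ over proper colorings $\kappa:V(G)\to\{1,2,\dots\}$ is the chromatic symmetric function. A clique is a set of pairwise adjacent vertices. The closed neighborhood of a vertex $v$ is the set consisting of $v$ and all vertices adjacent to $v$. (Under the hypotheses, $X_{H_i}$ does not depend on which $i$ edges are removed.) -}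

module Defs where

open import Data.Bool using (Bool; true; false; _∧_; _∨_; not)
open import Data.Nat using (ℕ; zero; suc; _≡ᵇ_)
open import Data.Fin using (Fin; zero; suc; _≟_)
open import Data.List using (List; []; _∷_; map; concatMap; allFin; filterᵇ; length; foldr)
open import Data.Vec using (lookup)
open import Data.Fin.Subset using (Subset)
open import Relation.Nullary using (does)

allᵇ : ∀ {A : Set} → (A → Bool) → List A → Bool
allᵇ p = foldr (λ a b → p a ∧ b) true

-- A finite simple graph on vertex set Fin n is given by a Boolean adjacency
-- function; symmetry and irreflexivity are imposed as hypotheses where used.
Graph : ℕ → Set
Graph n = Fin n → Fin n → Bool

_==_ : ∀ {n} → Fin n → Fin n → Bool
a == b = does (a ≟ b)

cons : ∀ {n m} → Fin m → (Fin n → Fin m) → Fin (suc n) → Fin m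
cons c f zero    = c
cons c f (suc i) = f i

allFuns : (n m : ℕ) → List (Fin n → Fin m)
allFuns zero    m = (λ ()) ∷ []
allFuns (suc n) m = concatMap (λ f → map (λ c → cons c f) (allFin m)) (allFuns n m)

isProperᵇ : ∀ {n m} → Graph n → (Fin n → Fin m) → Bool
isProperᵇ {n} G κ =
  allᵇ (λ u → allᵇ (λ v → not (G u v ∧ (κ u == κ v))) (allFin n)) (allFin n)

fiberSize : ∀ {n m} → (Fin n → Fin m) → Fin m → ℕ
fiberSize {n} κ c = length (filterᵇ (λ u → κ u == c) (allFin n))

-- κ has fiber sizes α (i.e. the monomial Π_v x_{κ v} equals x^α)
hasTypeᵇ : ∀ {n m} → (Fin m → ℕ) → (Fin n → Fin m) → Bool
hasTypeᵇ {n} {m} α κ = allᵇ (λ c → fiberSize κ c ≡ᵇ α c) (allFin m)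

-- Coefficient of the monomial x_1^{α 0} ⋯ x_m^{α (m-1)} in the chromatic
-- symmetric function X_G = Σ_κ Π_v x_{κ v}: the number of proper colorings
-- κ : V → {1,2,…} whose fiber sizes are α on colors 1..m (and 0 beyond),
-- i.e. proper colorings into Fin m with fiber sizes α.
-- Every monomial of ℤ[[x_1,x_2,…]] is of this form for some m, α.
chromCoeff : ∀ {n} → Graph n → (m : ℕ) → (Fin m → ℕ) → ℕ
chromCoeff {n} G m α =
  length (filterᵇ (λ κ → isProperᵇ G κ ∧ hasTypeᵇ α κ) (allFuns n m))

removeEdgesTo : ∀ {n} → Graph n → Fin n → Subset n → Graph n
removeEdgesTo H x S u v =
  H u v ∧ not (((u == x) ∧ lookup S v) ∨ ((v == x) ∧ lookup S u))

module Submission where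

-- Let H[K] be H with every edge between x and K removed; for S ⊆ K the graph H_S is H[K] together with the
-- edges from x to K ∖ S. A proper colouring of H[K] is injective on the clique K, so at most one vertex s of K
-- has the colour of x, and the colouring stays proper on H_S exactly when there is no such s or s ∈ S. Summing
-- over the colourings of a fixed type, each coefficient of X_{H_S} is therefore c + Σ_{s ∈ S} D(s), where D(s)
-- counts the colourings of H[K] of that type giving s the colour of x. In H[K] any two vertices of K have the
-- same closed neighbourhood, so the transposition exchanging them is an automorphism of H[K] fixing x, and D
-- is constant on K. The coefficient is thus affine in |S|, which is the three-term identity.

open import Defs

open import Data.Bool using (Bool; true; false; _∧_; not)
open import Data.Bool.Properties using (⇔→≡; T-≡)
open import Data.Empty using (⊥-elim)
open import Data.Fin using (Fin; zero; suc; _≟_)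
open import Data.Fin.Permutation using (Permutation′; _⟨$⟩ʳ_; _⟨$⟩ˡ_; inverseˡ; inverseʳ; transpose)
import Data.Fin.Permutation.Components as PC
open import Data.Fin.Properties using (all?; any?)
open import Data.Fin.Subset using (Subset; _∈_; _∉_; _⊆_; ∣_∣; ⊥; inside; outside)
open import Data.Fin.Subset.Properties using (_∈?_; ∉⊥; ⊥⊆; nonempty?)
open import Data.List using (List; []; _∷_; _++_; map; concatMap; allFin; filterᵇ; length)
open import Data.List.Properties using (map-tabulate)
open import Data.List.Relation.Unary.All using (All; []; _∷_)
open import Data.List.Relation.Unary.All.Properties using (tabulate⁺; tabulate⁻)
open import Data.Nat using (ℕ; zero; suc; _≤_)
import Data.Nat as ℕ
open import Data.Product using (_×_; _,_; proj₁; proj₂; ∃-syntax)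
open import Data.Product.Function.NonDependent.Propositional using (_×-⇔_)
open import Data.Sum using (_⊎_; inj₁; inj₂)
open import Data.Vec using (lookup; []; _∷_)
open import Function using (_∘_; id; case_of_)
open import Function.Bundles using (_⇔_; mk⇔; Equivalence)
import Function.Properties.Equivalence as ⇔
open import Relation.Binary.Core using (_Preserves_⟶_)
open import Relation.Binary.PropositionalEquality
open import Relation.Nullary using (¬_; Dec; yes; no; does; _because_; contradiction)
open import Relation.Nullary.Decidable using (does-⇔; dec-true; dec-false; _×-dec_; decidable-stable)
open import Relation.Nullary.Reflects using (fromEquivalence)

open Equivalence using (to; from)

private variable
  A B P Q : Set
  n m : ℕ

module FiniteSums where

  open import Data.Nat using (_+_; _*_)
  open import Data.Nat.Properties
    using (+-identityʳ; +-assoc; *-zeroʳ; *-identityˡ; *-identityʳ; *-comm; *-assoc; *-distribˡ-+;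
           +-commutativeSemigroup)
  open import Algebra.Properties.CommutativeSemigroup +-commutativeSemigroup using (interchange)

  ind : Bool → ℕ
  ind true  = 1
  ind false = 0

  𝟙 : Dec P → ℕ
  𝟙 p? = ind (does p?)

  ind-∧ : ∀ a b → ind (a ∧ b) ≡ ind a * ind b
  ind-∧ true  b = sym (+-identityʳ (ind b))
  ind-∧ false b = refl

  𝟙-× : (p? : Dec P) (q? : Dec Q) → 𝟙 (p? ×-dec q?) ≡ 𝟙 p? * 𝟙 q?
  𝟙-× p? q? = ind-∧ (does p?) (does q?)

  𝟙-cong : P ⇔ Q → (p? : Dec P) (q? : Dec Q) → 𝟙 p? ≡ 𝟙 q?
  𝟙-cong P⇔Q p? q? = cong ind (does-⇔ P⇔Q p? q?)

  𝟙-yes : (p? : Dec P) → P → 𝟙 p? ≡ 1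
  𝟙-yes p? p = cong ind (dec-true p? p)

  𝟙-no : (p? : Dec P) → ¬ P → 𝟙 p? ≡ 0
  𝟙-no p? ¬p = cong ind (dec-false p? ¬p)

  ∑ : List A → (A → ℕ) → ℕ
  ∑ []       f = 0
  ∑ (a ∷ as) f = f a + ∑ as f

  ∑-cong : ∀ (as : List A) {f g : A → ℕ} → f ≗ g → ∑ as f ≡ ∑ as g
  ∑-cong []       f≗g = refl
  ∑-cong (a ∷ as) f≗g = cong₂ _+_ (f≗g a) (∑-cong as f≗g)

  ∑-zero : ∀ (as : List A) {f : A → ℕ} → (∀ a → f a ≡ 0) → ∑ as f ≡ 0
  ∑-zero []       f≡0 = refl
  ∑-zero (a ∷ as) f≡0 = cong₂ _+_ (f≡0 a) (∑-zero as f≡0)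

  ∑-+ : ∀ (as : List A) (f g : A → ℕ) → ∑ as (λ a → f a + g a) ≡ ∑ as f + ∑ as g
  ∑-+ []       f g = refl
  ∑-+ (a ∷ as) f g =
    trans (cong (f a + g a +_) (∑-+ as f g)) (interchange (f a) (g a) (∑ as f) (∑ as g))

  ∑-*ˡ : ∀ (as : List A) c (f : A → ℕ) → ∑ as (λ a → c * f a) ≡ c * ∑ as f
  ∑-*ˡ []       c f = sym (*-zeroʳ c)
  ∑-*ˡ (a ∷ as) c f =
    trans (cong (c * f a +_) (∑-*ˡ as c f)) (sym (*-distribˡ-+ c (f a) (∑ as f)))

  ∑-*ʳ : ∀ (as : List A) c (f : A → ℕ) → ∑ as (λ a → f a * c) ≡ ∑ as f * c
  ∑-*ʳ as c f = trans (∑-cong as (λ a → *-comm (f a) c)) (trans (∑-*ˡ as c f) (*-comm c (∑ as f)))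

  ∑-comm : ∀ (as : List A) (bs : List B) (f : A → B → ℕ) →
           ∑ as (λ a → ∑ bs (f a)) ≡ ∑ bs (λ b → ∑ as (λ a → f a b))
  ∑-comm []       bs f = sym (∑-zero bs (λ _ → refl))
  ∑-comm (a ∷ as) bs f =
    trans (cong (∑ bs (f a) +_) (∑-comm as bs f)) (sym (∑-+ bs (f a) (λ b → ∑ as (λ a → f a b))))

  ∑-++ : ∀ (as bs : List A) (f : A → ℕ) → ∑ (as ++ bs) f ≡ ∑ as f + ∑ bs f
  ∑-++ []       bs f = refl
  ∑-++ (a ∷ as) bs f = trans (cong (f a +_) (∑-++ as bs f)) (sym (+-assoc (f a) (∑ as f) (∑ bs f)))

  ∑-map : ∀ (h : A → B) (as : List A) (f : B → ℕ) → ∑ (map h as) f ≡ ∑ as (f ∘ h)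
  ∑-map h []       f = refl
  ∑-map h (a ∷ as) f = cong (f (h a) +_) (∑-map h as f)

  ∑-concatMap : ∀ (h : A → List B) (as : List A) (f : B → ℕ) →
                ∑ (concatMap h as) f ≡ ∑ as (λ a → ∑ (h a) f)
  ∑-concatMap h []       f = refl
  ∑-concatMap h (a ∷ as) f =
    trans (∑-++ (h a) (concatMap h as) f) (cong (∑ (h a) f +_) (∑-concatMap h as f))

  length-filterᵇ : ∀ (p : A → Bool) (as : List A) → length (filterᵇ p as) ≡ ∑ as (ind ∘ p)
  length-filterᵇ p []       = refl
  length-filterᵇ p (a ∷ as) with p a
  ... | true  = cong suc (length-filterᵇ p as)
  ... | false = length-filterᵇ p as

  ∑-allFin-suc : ∀ (f : Fin (suc n) → ℕ) → ∑ (allFin (suc n)) f ≡ f zero + ∑ (allFin n) (f ∘ suc)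
  ∑-allFin-suc {n} f = cong (f zero +_)
    (trans (cong (λ is → ∑ is f) (sym (map-tabulate id suc))) (∑-map suc (allFin n) f))

  ∑-allFin-sift : ∀ (g : Fin n → ℕ) a → ∑ (allFin n) (λ b → 𝟙 (b ≟ a) * g b) ≡ g a
  ∑-allFin-sift {suc n} g zero =
    trans (∑-allFin-suc (λ b → 𝟙 (b ≟ zero) * g b))
          (trans (cong₂ _+_ (+-identityʳ (g zero)) (∑-zero (allFin n) (λ _ → refl))) (+-identityʳ (g zero)))
  ∑-allFin-sift {suc n} g (suc a) =
    trans (∑-allFin-suc (λ b → 𝟙 (b ≟ suc a) * g b)) (∑-allFin-sift (g ∘ suc) a)

  ∑-allFin-unique : ∀ {P : Fin n → Set} (P? : ∀ u → Dec (P u)) s → (∀ u → P u → u ≡ s) →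
                    ∑ (allFin n) (λ u → 𝟙 (P? u)) ≡ 𝟙 (P? s)
  ∑-allFin-unique {n} P? s only-s =
    trans (∑-cong (allFin n) δ-factor) (∑-allFin-sift (λ u → 𝟙 (P? u)) s)
    where
    δ-factor : ∀ u → 𝟙 (P? u) ≡ 𝟙 (u ≟ s) * 𝟙 (P? u)
    δ-factor u with u ≟ s
    ... | yes _  = sym (+-identityʳ (𝟙 (P? u)))
    ... | no u≢s = 𝟙-no (P? u) (u≢s ∘ only-s u)

  ∑-subset-const : ∀ (S : Subset n) (f : Fin n → ℕ) c → (∀ u → u ∈ S → f u ≡ c) →
                   ∑ (allFin n) (λ u → 𝟙 (u ∈? S) * f u) ≡ ∣ S ∣ * c
  ∑-subset-const {n} S f c f≡c =
    trans (∑-cong (allFin n) on-S)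
          (trans (∑-*ʳ (allFin n) c (λ u → 𝟙 (u ∈? S))) (cong (_* c) (∑-card S)))
    where
    on-S : ∀ u → 𝟙 (u ∈? S) * f u ≡ 𝟙 (u ∈? S) * c
    on-S u with u ∈? S
    ... | yes u∈S = cong (_+ 0) (f≡c u u∈S)
    ... | no _    = refl

    ∑-card : ∀ {n} (S : Subset n) → ∑ (allFin n) (λ u → 𝟙 (u ∈? S)) ≡ ∣ S ∣
    ∑-card []            = refl
    ∑-card (inside ∷ S)  = trans (∑-allFin-suc (λ u → 𝟙 (u ∈? (inside ∷ S)))) (cong suc (∑-card S))
    ∑-card (outside ∷ S) = trans (∑-allFin-suc (λ u → 𝟙 (u ∈? (outside ∷ S)))) (∑-card S)

  module _ {_≈_ : A → A → Set} (_≈?_ : ∀ a b → Dec (a ≈ b)) where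

    -- every element is ≈ to exactly one entry of the list, phrased as the sifting property of the
    -- Kronecker delta
    IsEnumeration : List A → Set
    IsEnumeration as =
      ∀ (g : A → ℕ) → g Preserves _≈_ ⟶ _≡_ → ∀ a → ∑ as (λ b → 𝟙 (b ≈? a) * g b) ≡ g a

    ∑-reindex : ∀ as → IsEnumeration as → (φ ψ : A → A) → (∀ a b → b ≈ φ a ⇔ a ≈ ψ b) →
                ∀ (g : A → ℕ) → g Preserves _≈_ ⟶ _≡_ → ∑ as (g ∘ φ) ≡ ∑ as g
    ∑-reindex as sift φ ψ φ⇔ψ g g-resp = begin
      ∑ as (g ∘ φ)
        ≡⟨ ∑-cong as (λ a → sym (sift g g-resp (φ a))) ⟩
      ∑ as (λ a → ∑ as (λ b → 𝟙 (b ≈? φ a) * g b))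
        ≡⟨ ∑-comm as as _ ⟩
      ∑ as (λ b → ∑ as (λ a → 𝟙 (b ≈? φ a) * g b))
        ≡⟨ ∑-cong as (λ b → ∑-cong as (λ a → cong (_* g b) (𝟙-cong (φ⇔ψ a b) (b ≈? φ a) (a ≈? ψ b)))) ⟩
      ∑ as (λ b → ∑ as (λ a → 𝟙 (a ≈? ψ b) * g b))
        ≡⟨ ∑-cong as (λ b → trans (∑-*ʳ as (g b) _) (cong (_* g b) (occurs-once (ψ b)))) ⟩
      ∑ as (λ b → 1 * g b)
        ≡⟨ ∑-cong as (λ b → *-identityˡ (g b)) ⟩
      ∑ as g ∎
      where
      open ≡-Reasoning
      occurs-once : ∀ a → ∑ as (λ b → 𝟙 (b ≈? a)) ≡ 1
      occurs-once a = trans (∑-cong as (λ b → sym (*-identityʳ _))) (sift (λ _ → 1) (λ _ → refl) a)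

  ∑-allFin-permute : ∀ (π : Permutation′ n) (g : Fin n → ℕ) →
                     ∑ (allFin n) (g ∘ (π ⟨$⟩ʳ_)) ≡ ∑ (allFin n) g
  ∑-allFin-permute π g =
    ∑-reindex _≟_ (allFin _) (λ g _ → ∑-allFin-sift g) (π ⟨$⟩ʳ_) (π ⟨$⟩ˡ_) inverse g (cong g)
    where
    inverse : ∀ a b → b ≡ π ⟨$⟩ʳ a ⇔ a ≡ π ⟨$⟩ˡ b
    inverse a b = mk⇔ (λ b≡πa → trans (sym (inverseˡ π)) (cong (π ⟨$⟩ˡ_) (sym b≡πa)))
                      (λ a≡π⁻¹b → trans (sym (inverseʳ π)) (cong (π ⟨$⟩ʳ_) (sym a≡π⁻¹b)))

  infix 4 _≗?_
  _≗?_ : (f g : Fin n → Fin m) → Dec (f ≗ g)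
  f ≗? g = all? (λ i → f i ≟ g i)

  cons-≗ : ∀ (c : Fin m) (f : Fin n → Fin m) (κ : Fin (suc n) → Fin m) →
           cons c f ≗ κ ⇔ (c ≡ κ zero × f ≗ κ ∘ suc)
  cons-≗ c f κ = mk⇔ (λ e → e zero , e ∘ suc) (λ { (e₀ , e) zero → e₀ ; (e₀ , e) (suc i) → e i })

  ∑-allFuns-sift : IsEnumeration _≗?_ (allFuns n m)
  ∑-allFuns-sift {zero}      g g-resp κ = trans (+-identityʳ _) (trans (+-identityʳ _) (g-resp (λ ())))
  ∑-allFuns-sift {suc n} {m} g g-resp κ = begin
    ∑ (allFuns (suc n) m) (λ ρ → 𝟙 (ρ ≗? κ) * g ρ)
      ≡⟨ ∑-concatMap _ (allFuns n m) _ ⟩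
    ∑ (allFuns n m) (λ f → ∑ (map (λ c → cons c f) (allFin m)) (λ ρ → 𝟙 (ρ ≗? κ) * g ρ))
      ≡⟨ ∑-cong (allFuns n m) (λ f → ∑-map _ (allFin m) _) ⟩
    ∑ (allFuns n m) (λ f → ∑ (allFin m) (λ c → 𝟙 (cons c f ≗? κ) * g (cons c f)))
      ≡⟨ ∑-cong (allFuns n m) (λ f → ∑-cong (allFin m) (split f)) ⟩
    ∑ (allFuns n m) (λ f → ∑ (allFin m) (λ c → 𝟙 (c ≟ κ zero) * (𝟙 (f ≗? κ ∘ suc) * g (cons c f))))
      ≡⟨ ∑-cong (allFuns n m) (λ f → ∑-allFin-sift _ (κ zero)) ⟩
    ∑ (allFuns n m) (λ f → 𝟙 (f ≗? κ ∘ suc) * g (cons (κ zero) f))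
      ≡⟨ ∑-allFuns-sift (g ∘ cons (κ zero)) (g-resp ∘ cons-resp) (κ ∘ suc) ⟩
    g (cons (κ zero) (κ ∘ suc))
      ≡⟨ g-resp (from (cons-≗ (κ zero) (κ ∘ suc) κ) (refl , λ _ → refl)) ⟩
    g κ ∎
    where
    open ≡-Reasoning
    split : ∀ f c → 𝟙 (cons c f ≗? κ) * g (cons c f) ≡ 𝟙 (c ≟ κ zero) * (𝟙 (f ≗? κ ∘ suc) * g (cons c f))
    split f c = begin
      𝟙 (cons c f ≗? κ) * g (cons c f)
        ≡⟨ cong (_* g (cons c f))
                (𝟙-cong (cons-≗ c f κ) (cons c f ≗? κ) (c ≟ κ zero ×-dec f ≗? κ ∘ suc)) ⟩
      𝟙 (c ≟ κ zero ×-dec f ≗? κ ∘ suc) * g (cons c f)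
        ≡⟨ cong (_* g (cons c f)) (𝟙-× (c ≟ κ zero) (f ≗? κ ∘ suc)) ⟩
      𝟙 (c ≟ κ zero) * 𝟙 (f ≗? κ ∘ suc) * g (cons c f)
        ≡⟨ *-assoc (𝟙 (c ≟ κ zero)) (𝟙 (f ≗? κ ∘ suc)) (g (cons c f)) ⟩
      𝟙 (c ≟ κ zero) * (𝟙 (f ≗? κ ∘ suc) * g (cons c f)) ∎
    cons-resp : ∀ {c} {f f′ : Fin n → Fin m} → f ≗ f′ → cons c f ≗ cons c f′
    cons-resp f≗f′ zero    = refl
    cons-resp f≗f′ (suc i) = f≗f′ i

  ∑-allFuns-permute : ∀ (π : Permutation′ n) (g : (Fin n → Fin m) → ℕ) → g Preserves _≗_ ⟶ _≡_ →
                      ∑ (allFuns n m) (λ κ → g (κ ∘ (π ⟨$⟩ʳ_))) ≡ ∑ (allFuns n m) g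
  ∑-allFuns-permute π g g-resp =
    ∑-reindex _≗?_ (allFuns _ _) ∑-allFuns-sift (_∘ (π ⟨$⟩ʳ_)) (_∘ (π ⟨$⟩ˡ_)) inverse g g-resp
    where
    inverse : ∀ κ ρ → ρ ≗ κ ∘ (π ⟨$⟩ʳ_) ⇔ κ ≗ ρ ∘ (π ⟨$⟩ˡ_)
    inverse κ ρ = mk⇔ (λ e i → trans (cong κ (sym (inverseʳ π))) (sym (e (π ⟨$⟩ˡ i))))
                      (λ e i → trans (cong ρ (sym (inverseˡ π))) (sym (e (π ⟨$⟩ʳ i))))

module Colourings where

  open FiniteSums
  open import Data.Nat using (_*_; _≡ᵇ_)

  Proper : Graph n → (Fin n → Fin m) → Set
  Proper G κ = ∀ u v → G u v ≡ true → κ u ≢ κ v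

  IsSymmetric : Graph n → Set
  IsSymmetric G = ∀ u v → G u v ≡ G v u

  IsIrreflexive : Graph n → Set
  IsIrreflexive G = ∀ v → G v v ≡ false

  allᵇ⇔All : ∀ (p : A → Bool) as → allᵇ p as ≡ true ⇔ All (λ a → p a ≡ true) as
  allᵇ⇔All p []       = mk⇔ (λ _ → []) (λ _ → refl)
  allᵇ⇔All p (a ∷ as) with p a in pa
  ... | true  = mk⇔ (λ e → pa ∷ to (allᵇ⇔All p as) e) (λ { (_ ∷ ps) → from (allᵇ⇔All p as) ps })
  ... | false = mk⇔ (λ ()) (λ { (pa′ ∷ _) → trans (sym pa) pa′ })

  allᵇ-allFin : ∀ (p : Fin n → Bool) → allᵇ p (allFin n) ≡ true ⇔ (∀ i → p i ≡ true)
  allᵇ-allFin p = mk⇔ (tabulate⁻ ∘ to (allᵇ⇔All p _)) (from (allᵇ⇔All p _) ∘ tabulate⁺)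

  allᵇ-cong : ∀ {p q : A → Bool} as → (∀ a → p a ≡ q a) → allᵇ p as ≡ allᵇ q as
  allᵇ-cong []       p≗q = refl
  allᵇ-cong (a ∷ as) p≗q = cong₂ _∧_ (p≗q a) (allᵇ-cong as p≗q)

  isProperᵇ⇔Proper : ∀ (G : Graph n) (κ : Fin n → Fin m) → isProperᵇ G κ ≡ true ⇔ Proper G κ
  isProperᵇ⇔Proper G κ = mk⇔
    (λ e u v → to (edge u v) (to (allᵇ-allFin _) (to (allᵇ-allFin _) e u) v))
    (λ p → from (allᵇ-allFin _) (λ u → from (allᵇ-allFin _) (λ v → from (edge u v) (p u v))))
    where
    edge : ∀ u v → not (G u v ∧ (κ u == κ v)) ≡ true ⇔ (G u v ≡ true → κ u ≢ κ v)
    edge u v with G u v | κ u ≟ κ v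
    ... | true  | yes κu≡κv = mk⇔ (λ ()) (λ apart → ⊥-elim (apart refl κu≡κv))
    ... | true  | no κu≢κv  = mk⇔ (λ _ _ → κu≢κv) (λ _ → refl)
    ... | false | _         = mk⇔ (λ _ ()) (λ _ → refl)

  -- its boolean part is isProperᵇ G κ itself, so 𝟙 (proper? G κ) is the indicator that chromCoeff counts
  proper? : (G : Graph n) (κ : Fin n → Fin m) → Dec (Proper G κ)
  proper? G κ = isProperᵇ G κ because fromEquivalence
    (to (isProperᵇ⇔Proper G κ) ∘ to T-≡) (from T-≡ ∘ from (isProperᵇ⇔Proper G κ))

  chromCoeff-∑ : ∀ (G : Graph n) m α →
                 chromCoeff G m α ≡ ∑ (allFuns n m) (λ κ → 𝟙 (proper? G κ) * ind (hasTypeᵇ α κ))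
  chromCoeff-∑ {n} G m α = trans (length-filterᵇ _ (allFuns n m))
    (∑-cong (allFuns n m) (λ κ → ind-∧ (isProperᵇ G κ) (hasTypeᵇ α κ)))

  Proper-≗ : ∀ {G : Graph n} {κ κ′ : Fin n → Fin m} → κ ≗ κ′ → Proper G κ → Proper G κ′
  Proper-≗ κ≗κ′ proper u v e eq = proper u v e (trans (κ≗κ′ u) (trans eq (sym (κ≗κ′ v))))

  fiberSize-∑ : ∀ (κ : Fin n → Fin m) c → fiberSize κ c ≡ ∑ (allFin n) (λ u → 𝟙 (κ u ≟ c))
  fiberSize-∑ {n} κ c = length-filterᵇ _ (allFin n)

  hasTypeᵇ-fiberSize : ∀ (α : Fin m → ℕ) (κ κ′ : Fin n → Fin m) →
                       (∀ c → fiberSize κ c ≡ fiberSize κ′ c) → hasTypeᵇ α κ ≡ hasTypeᵇ α κ′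
  hasTypeᵇ-fiberSize {m} α κ κ′ same = allᵇ-cong (allFin m) (λ c → cong (_≡ᵇ α c) (same c))

  hasTypeᵇ-≗ : ∀ (α : Fin m → ℕ) {κ κ′ : Fin n → Fin m} → κ ≗ κ′ → hasTypeᵇ α κ ≡ hasTypeᵇ α κ′
  hasTypeᵇ-≗ {n = n} α {κ} {κ′} κ≗κ′ = hasTypeᵇ-fiberSize α κ κ′ λ c →
    trans (fiberSize-∑ κ c)
          (trans (∑-cong (allFin n) (λ u → cong (λ a → 𝟙 (a ≟ c)) (κ≗κ′ u))) (sym (fiberSize-∑ κ′ c)))

  hasTypeᵇ-permute : ∀ (α : Fin m → ℕ) (π : Permutation′ n) (κ : Fin n → Fin m) →
                     hasTypeᵇ α (κ ∘ (π ⟨$⟩ʳ_)) ≡ hasTypeᵇ α κ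
  hasTypeᵇ-permute α π κ = hasTypeᵇ-fiberSize α (κ ∘ (π ⟨$⟩ʳ_)) κ λ c →
    trans (fiberSize-∑ (κ ∘ (π ⟨$⟩ʳ_)) c)
          (trans (∑-allFin-permute π (λ u → 𝟙 (κ u ≟ c))) (sym (fiberSize-∑ κ c)))

  Automorphism : Graph n → Permutation′ n → Set
  Automorphism G π = ∀ u v → G (π ⟨$⟩ʳ u) (π ⟨$⟩ʳ v) ≡ G u v

  Proper-automorphism : ∀ {G : Graph n} {π} → Automorphism G π → (κ : Fin n → Fin m) →
                        Proper G (κ ∘ (π ⟨$⟩ʳ_)) ⇔ Proper G κ
  Proper-automorphism {G = G} {π} aut κ = mk⇔
    (λ proper u v e eq → proper (π ⟨$⟩ˡ u) (π ⟨$⟩ˡ v)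
       (trans (sym (aut _ _)) (trans (cong₂ G (inverseʳ π) (inverseʳ π)) e))
       (trans (cong κ (inverseʳ π)) (trans eq (sym (cong κ (inverseʳ π))))))
    (λ proper u v e → proper (π ⟨$⟩ʳ u) (π ⟨$⟩ʳ v) (trans (aut u v) e))

  data Transposition (i j : Fin n) : Fin n → Fin n → Set where
    left  : Transposition i j i j
    right : Transposition i j j i
    fixed : ∀ {k} → k ≢ i → k ≢ j → Transposition i j k k

  transposition : ∀ (i j k : Fin n) → Transposition i j k (PC.transpose i j k)
  transposition i j k with k ≟ i
  ... | yes refl = left
  ... | no k≢i with k ≟ j
  ...   | yes refl = right
  ...   | no k≢j   = fixed k≢i k≢j

  transpose-matchʳ : ∀ (i j : Fin n) → PC.transpose i j j ≡ i
  transpose-matchʳ i j = match (transposition i j j) refl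
    where
    match : ∀ {k k′} → Transposition i j k k′ → k ≡ j → k′ ≡ i
    match left          i≡j = sym i≡j
    match right         _   = refl
    match (fixed _ k≢j) k≡j = contradiction k≡j k≢j

  transpose-fixed : ∀ {i j k : Fin n} → k ≢ i → k ≢ j → PC.transpose i j k ≡ k
  transpose-fixed {i = i} {j} {k} = fix (transposition i j k)
    where
    fix : ∀ {k k′} → Transposition i j k k′ → k ≢ i → k ≢ j → k′ ≡ k
    fix left        k≢i _   = contradiction refl k≢i
    fix right       _   k≢j = contradiction refl k≢j
    fix (fixed _ _) _   _   = refl

  ClosedTwins : Graph n → Fin n → Fin n → Set
  ClosedTwins G u w = ∀ z → (z ≡ u ⊎ G u z ≡ true) ⇔ (z ≡ w ⊎ G w z ≡ true)

  closedTwins-sym : ∀ {G : Graph n} {u w} → ClosedTwins G u w → ClosedTwins G w u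
  closedTwins-sym twins z = ⇔.sym (twins z)

  closedTwin-adj : ∀ {G : Graph n} {u w z} → ClosedTwins G u w → z ≢ w → G u z ≡ true → G w z ≡ true
  closedTwin-adj twins z≢w e with to (twins _) (inj₂ e)
  ... | inj₁ z≡w = contradiction z≡w z≢w
  ... | inj₂ e′  = e′

  transpose-closedTwins-adj :
    ∀ {G : Graph n} {u w} → IsSymmetric G → IsIrreflexive G → ClosedTwins G u w →
    ∀ {a b} → G a b ≡ true → G (PC.transpose u w a) (PC.transpose u w b) ≡ true
  transpose-closedTwins-adj {G = G} {u} {w} G-sym G-irr twins {a} {b} =
    go (transposition u w a) (transposition u w b)
    where
    no-loop : ∀ {v} → G v v ≢ true
    no-loop {v} e = contradiction (trans (sym e) (G-irr v)) λ ()
    twins′ : ClosedTwins G w u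
    twins′ = closedTwins-sym twins
    go : ∀ {a a′ b b′} → Transposition u w a a′ → Transposition u w b b′ → G a b ≡ true → G a′ b′ ≡ true
    go left              left          e = ⊥-elim (no-loop e)
    go left              right         e = trans (G-sym w u) e
    go left              (fixed _ b≢w) e = closedTwin-adj twins b≢w e
    go right             left          e = trans (G-sym u w) e
    go right             right         e = ⊥-elim (no-loop e)
    go right             (fixed b≢u _) e = closedTwin-adj twins′ b≢u e
    go (fixed {a} _ a≢w) left          e = trans (G-sym a w) (closedTwin-adj twins a≢w (trans (G-sym u a) e))
    go (fixed {a} a≢u _) right         e = trans (G-sym a u) (closedTwin-adj twins′ a≢u (trans (G-sym w a) e))
    go (fixed _ _)       (fixed _ _)   e = e

  transpose-closedTwins : ∀ {G : Graph n} {u w} → IsSymmetric G → IsIrreflexive G → ClosedTwins G u w →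
                          Automorphism G (transpose u w)
  transpose-closedTwins {G = G} {u} {w} G-sym G-irr twins a b =
    ⇔→≡ (mk⇔ back (transpose-closedTwins-adj G-sym G-irr twins))
    where
    back : G (PC.transpose u w a) (PC.transpose u w b) ≡ true → G a b ≡ true
    back e = subst₂ (λ a′ b′ → G a′ b′ ≡ true) (PC.transpose-inverse w u) (PC.transpose-inverse w u)
                    (transpose-closedTwins-adj G-sym G-irr (closedTwins-sym twins) e)

module EdgeRemoval {n : ℕ} (H : Graph n) (x : Fin n) where

  open Colourings using (IsSymmetric; IsIrreflexive)

  lookup≡does-∈? : ∀ {n} (S : Subset n) (u : Fin n) → lookup S u ≡ does (u ∈? S)
  lookup≡does-∈? (inside ∷ S)  zero    = refl
  lookup≡does-∈? (outside ∷ S) zero    = refl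
  lookup≡does-∈? (_ ∷ S)       (suc u) = lookup≡does-∈? S u

  removeEdgesTo-adj : ∀ S u v →
    removeEdgesTo H x S u v ≡ true ⇔ (H u v ≡ true × (u ≡ x → v ∉ S) × (v ≡ x → u ∉ S))
  removeEdgesTo-adj S u v
    rewrite lookup≡does-∈? S u | lookup≡does-∈? S v
    with H u v | u ≟ x | v ∈? S | v ≟ x | u ∈? S
  ... | false | _       | _       | _       | _       = mk⇔ (λ ()) (λ { (() , _) })
  ... | true  | yes u≡x | yes v∈S | _       | _       =
    mk⇔ (λ ()) (λ (_ , v∉S , _) → contradiction v∈S (v∉S u≡x))
  ... | true  | yes _   | no _    | yes v≡x | yes u∈S =
    mk⇔ (λ ()) (λ (_ , _ , u∉S) → contradiction u∈S (u∉S v≡x))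
  ... | true  | no _    | _       | yes v≡x | yes u∈S =
    mk⇔ (λ ()) (λ (_ , _ , u∉S) → contradiction u∈S (u∉S v≡x))
  ... | true  | yes _   | no v∉S  | yes _   | no u∉S  = mk⇔ (λ _ → refl , (λ _ → v∉S) , (λ _ → u∉S)) λ _ → refl
  ... | true  | yes _   | no v∉S  | no v≢x  | _       = mk⇔ (λ _ → refl , (λ _ → v∉S) , ⊥-elim ∘ v≢x) λ _ → refl
  ... | true  | no u≢x  | _       | yes _   | no u∉S  = mk⇔ (λ _ → refl , ⊥-elim ∘ u≢x , (λ _ → u∉S)) λ _ → refl
  ... | true  | no u≢x  | _       | no v≢x  | _       = mk⇔ (λ _ → refl , ⊥-elim ∘ u≢x , ⊥-elim ∘ v≢x) λ _ → refl

  removeEdgesTo-sym : IsSymmetric H → ∀ S → IsSymmetric (removeEdgesTo H x S)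
  removeEdgesTo-sym H-sym S u v = ⇔→≡ (mk⇔ (flip u v) (flip v u))
    where
    flip : ∀ a b → removeEdgesTo H x S a b ≡ true → removeEdgesTo H x S b a ≡ true
    flip a b e = let h , p , q = to (removeEdgesTo-adj S a b) e
                 in from (removeEdgesTo-adj S b a) (trans (H-sym b a) h , q , p)

  removeEdgesTo-irr : IsIrreflexive H → ∀ S → IsIrreflexive (removeEdgesTo H x S)
  removeEdgesTo-irr H-irr S v with removeEdgesTo H x S v v in e
  ... | true  = trans (sym (proj₁ (to (removeEdgesTo-adj S v v) e))) (H-irr v)
  ... | false = refl

  removeEdgesTo-away : ∀ S {u v} → u ≢ x → v ≢ x → removeEdgesTo H x S u v ≡ H u v
  removeEdgesTo-away S {u} {v} u≢x v≢x = ⇔→≡ (mk⇔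
    (proj₁ ∘ to (removeEdgesTo-adj S u v))
    (λ h → from (removeEdgesTo-adj S u v) (h , ⊥-elim ∘ u≢x , ⊥-elim ∘ v≢x)))

  removeEdgesTo-antitone : ∀ {S T} → S ⊆ T →
                           ∀ {u v} → removeEdgesTo H x T u v ≡ true → removeEdgesTo H x S u v ≡ true
  removeEdgesTo-antitone {S} {T} S⊆T {u} {v} e =
    let h , p , q = to (removeEdgesTo-adj T u v) e
    in from (removeEdgesTo-adj S u v) (h , (λ u≡x → p u≡x ∘ S⊆T) , (λ v≡x → q v≡x ∘ S⊆T))

  removeEdgesTo-split : ∀ S T {u v} → removeEdgesTo H x S u v ≡ true →
    removeEdgesTo H x T u v ≡ true ⊎ (u ≡ x × v ∈ T × v ∉ S) ⊎ (v ≡ x × u ∈ T × u ∉ S)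
  removeEdgesTo-split S T {u} {v} e with to (removeEdgesTo-adj S u v) e
  ... | h , p , q with u ≟ x ×-dec v ∈? T | v ≟ x ×-dec u ∈? T
  ...   | yes (u≡x , v∈T) | _               = inj₂ (inj₁ (u≡x , v∈T , p u≡x))
  ...   | no _            | yes (v≡x , u∈T) = inj₂ (inj₂ (v≡x , u∈T , q v≡x))
  ...   | no ¬ux          | no ¬vx          =
    inj₁ (from (removeEdgesTo-adj T u v)
                (h , (λ u≡x v∈T → ¬ux (u≡x , v∈T)) , (λ v≡x u∈T → ¬vx (v≡x , u∈T))))

  removeEdgesTo-kept : ∀ S {v} → H x v ≡ true → v ≢ x → v ∉ S → removeEdgesTo H x S x v ≡ true
  removeEdgesTo-kept S h v≢x v∉S = from (removeEdgesTo-adj S x _) (h , (λ _ → v∉S) , ⊥-elim ∘ v≢x)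

module CliqueJoin
  {n : ℕ} (H : Graph n) (H-sym : ∀ u v → H u v ≡ H v u) (H-irr : ∀ v → H v v ≡ false)
  (K : Subset n) (K-clique : ∀ u v → u ∈ K → v ∈ K → u ≢ v → H u v ≡ true)
  (x : Fin n) (x∉K : x ∉ K) (x-joined : ∀ v → v ∈ K → H x v ≡ true)
  (K-twins : ∀ u v → u ∈ K → v ∈ K → ∀ w → w ≢ x → ((w ≡ u ⊎ H u w ≡ true) ⇔ (w ≡ v ⊎ H v w ≡ true)))
  where

  open import Data.Nat using (_+_; _*_)
  open import Data.Nat.Properties using (*-zeroʳ; *-assoc; *-distribʳ-+)
  open FiniteSums
  open Colourings
  open EdgeRemoval H x

  H[_] : Subset n → Graph n
  H[ S ] = removeEdgesTo H x S

  ∈K⇒≢x : ∀ {u} → u ∈ K → u ≢ x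
  ∈K⇒≢x u∈K refl = x∉K u∈K

  H[K]-closedTwins : ∀ {u w} → u ∈ K → w ∈ K → ClosedTwins H[ K ] u w
  H[K]-closedTwins {u} {w} u∈K w∈K z = twins-at (z ≟ x)
    where
    not-adjacent : ∀ {v} → v ∈ K → z ≡ x → ¬ (z ≡ v ⊎ H[ K ] v z ≡ true)
    not-adjacent v∈K z≡x (inj₁ z≡v) = ∈K⇒≢x v∈K (trans (sym z≡v) z≡x)
    not-adjacent v∈K z≡x (inj₂ e)   = proj₂ (proj₂ (to (removeEdgesTo-adj K _ z) e)) z≡x v∈K
    twins-at : Dec (z ≡ x) → (z ≡ u ⊎ H[ K ] u z ≡ true) ⇔ (z ≡ w ⊎ H[ K ] w z ≡ true)
    twins-at (yes z≡x) = mk⇔ (⊥-elim ∘ not-adjacent u∈K z≡x) (⊥-elim ∘ not-adjacent w∈K z≡x)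
    twins-at (no z≢x)  =
      subst₂ (λ a b → (z ≡ u ⊎ a ≡ true) ⇔ (z ≡ w ⊎ b ≡ true))
             (sym (removeEdgesTo-away K (∈K⇒≢x u∈K) z≢x)) (sym (removeEdgesTo-away K (∈K⇒≢x w∈K) z≢x))
             (K-twins u w u∈K w∈K z z≢x)

  transpose-H[K] : ∀ {u w} → u ∈ K → w ∈ K → Automorphism H[ K ] (transpose u w)
  transpose-H[K] u∈K w∈K =
    transpose-closedTwins (removeEdgesTo-sym H-sym K) (removeEdgesTo-irr H-irr K) (H[K]-closedTwins u∈K w∈K)

  proper-injective : ∀ {κ : Fin n → Fin m} → Proper H[ K ] κ →
                     ∀ {u w} → u ∈ K → w ∈ K → κ u ≡ κ w → u ≡ w
  proper-injective proper {u} {w} u∈K w∈K κu≡κw = decidable-stable (u ≟ w) λ u≢w →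
    proper u w (trans (removeEdgesTo-away K (∈K⇒≢x u∈K) (∈K⇒≢x w∈K)) (K-clique u w u∈K w∈K u≢w)) κu≡κw

  proper-H[_]⇔ : ∀ S → S ⊆ K → (κ : Fin n → Fin m) →
                 Proper H[ S ] κ ⇔ (Proper H[ K ] κ × (∀ v → v ∈ K → v ∉ S → κ v ≢ κ x))
  proper-H[ S ]⇔ S⊆K κ = mk⇔
    (λ proper → (λ u v e → proper u v (removeEdgesTo-antitone S⊆K e)) ,
                (λ v v∈K v∉S κv≡κx →
                   proper x v (removeEdgesTo-kept S (x-joined v v∈K) (∈K⇒≢x v∈K) v∉S) (sym κv≡κx)))
    (λ (proper , apart) u v e κu≡κv → case removeEdgesTo-split S K e of λ where
       (inj₁ e′)                        → proper u v e′ κu≡κv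
       (inj₂ (inj₁ (u≡x , v∈K , v∉S))) → apart v v∈K v∉S (trans (sym κu≡κv) (cong κ u≡x))
       (inj₂ (inj₂ (v≡x , u∈K , u∉S))) → apart u u∈K u∉S (trans κu≡κv (cong κ v≡x)))

  module _ {S : Subset n} (S⊆K : S ⊆ K) (κ : Fin n → Fin m) where

    sharersIn : ℕ
    sharersIn = ∑ (allFin n) (λ u → 𝟙 (u ∈? S ×-dec κ u ≟ κ x))

    𝟙-proper-improper : ¬ Proper H[ K ] κ → 𝟙 (proper? H[ S ] κ) ≡ 0
    𝟙-proper-improper improper = 𝟙-no (proper? H[ S ] κ) (improper ∘ proj₁ ∘ to (proper-H[ S ]⇔ S⊆K κ))

    module _ (proper : Proper H[ K ] κ) where

      𝟙-proper-unshared : (∀ v → v ∈ K → κ v ≢ κ x) → 𝟙 (proper? H[ S ] κ) ≡ 1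
      𝟙-proper-unshared unshared =
        𝟙-yes (proper? H[ S ] κ) (from (proper-H[ S ]⇔ S⊆K κ) (proper , λ v v∈K _ → unshared v v∈K))

      sharersIn-unshared : (∀ v → v ∈ K → κ v ≢ κ x) → sharersIn ≡ 0
      sharersIn-unshared unshared = ∑-zero (allFin n) λ u →
        𝟙-no (u ∈? S ×-dec κ u ≟ κ x) (λ (u∈S , κu≡κx) → unshared u (S⊆K u∈S) κu≡κx)

      module _ {s} (s∈K : s ∈ K) (κs≡κx : κ s ≡ κ x) where

        only-s-shares : ∀ {v} → v ∈ K → κ v ≡ κ x → v ≡ s
        only-s-shares v∈K κv≡κx = proper-injective proper v∈K s∈K (trans κv≡κx (sym κs≡κx))

        𝟙-proper-shared : 𝟙 (proper? H[ S ] κ) ≡ 𝟙 (s ∈? S)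
        𝟙-proper-shared = 𝟙-cong (mk⇔ proper⇒s∈S s∈S⇒proper) (proper? H[ S ] κ) (s ∈? S)
          where
          proper⇒s∈S : Proper H[ S ] κ → s ∈ S
          proper⇒s∈S p = decidable-stable (s ∈? S) λ s∉S → proj₂ (to (proper-H[ S ]⇔ S⊆K κ) p) s s∈K s∉S κs≡κx
          s∈S⇒proper : s ∈ S → Proper H[ S ] κ
          s∈S⇒proper s∈S = from (proper-H[ S ]⇔ S⊆K κ)
            (proper , λ v v∈K v∉S κv≡κx → v∉S (subst (_∈ S) (sym (only-s-shares v∈K κv≡κx)) s∈S))

        sharersIn-shared : sharersIn ≡ 𝟙 (s ∈? S)
        sharersIn-shared =
          trans (∑-allFin-unique (λ u → u ∈? S ×-dec κ u ≟ κ x) s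
                                 (λ u (u∈S , κu≡κx) → only-s-shares (S⊆K u∈S) κu≡κx))
                (𝟙-cong (mk⇔ proj₁ (_, κs≡κx)) (s ∈? S ×-dec κ s ≟ κ x) (s ∈? S))

  𝟙-proper-H[_] : ∀ S → S ⊆ K → (κ : Fin n → Fin m) →
    𝟙 (proper? H[ S ] κ) ≡
    𝟙 (proper? H[ ⊥ ] κ) + ∑ (allFin n) (λ u → 𝟙 (u ∈? S) * 𝟙 (proper? H[ K ] κ ×-dec κ u ≟ κ x))
  𝟙-proper-H[ S ] S⊆K κ = by-cases (proper? H[ K ] κ) (any? (λ s → s ∈? K ×-dec κ s ≟ κ x))
    where
    sharersIn-∑ : sharersIn S⊆K κ ≡ ∑ (allFin n) (λ u → 𝟙 (u ∈? S) * 𝟙 (κ u ≟ κ x))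
    sharersIn-∑ = ∑-cong (allFin n) (λ u → 𝟙-× (u ∈? S) (κ u ≟ κ x))
    -- the decision for H[ K ] is abstracted by hand: `with` cannot find it inside the unfolded 𝟙
    by-cases : (proper-K? : Dec (Proper H[ K ] κ)) → Dec (∃[ s ] s ∈ K × κ s ≡ κ x) →
      𝟙 (proper? H[ S ] κ) ≡
      𝟙 (proper? H[ ⊥ ] κ) + ∑ (allFin n) (λ u → 𝟙 (u ∈? S) * 𝟙 (proper-K? ×-dec κ u ≟ κ x))
    by-cases (no improper) _ =
      trans (𝟙-proper-improper S⊆K κ improper)
            (sym (cong₂ _+_ (𝟙-proper-improper ⊥⊆ κ improper)
                            (∑-zero (allFin n) (λ u → *-zeroʳ (𝟙 (u ∈? S))))))
    by-cases (yes proper) (no no-sharer) =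
      trans (𝟙-proper-unshared S⊆K κ proper unshared)
            (sym (cong₂ _+_ (𝟙-proper-unshared ⊥⊆ κ proper unshared)
                            (trans (sym sharersIn-∑) (sharersIn-unshared S⊆K κ proper unshared))))
      where
      unshared : ∀ v → v ∈ K → κ v ≢ κ x
      unshared v v∈K κv≡κx = no-sharer (v , v∈K , κv≡κx)
    by-cases (yes proper) (yes (s , s∈K , κs≡κx)) =
      trans (𝟙-proper-shared S⊆K κ proper s∈K κs≡κx)
            (sym (cong₂ _+_ (trans (𝟙-proper-shared ⊥⊆ κ proper s∈K κs≡κx) (𝟙-no (s ∈? ⊥) ∉⊥))
                            (trans (sym sharersIn-∑) (sharersIn-shared S⊆K κ proper s∈K κs≡κx))))

  module _ (m : ℕ) (α : Fin m → ℕ) where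

    sharesColourOfX : Fin n → (Fin n → Fin m) → ℕ
    sharesColourOfX u κ = 𝟙 (proper? H[ K ] κ ×-dec κ u ≟ κ x) * ind (hasTypeᵇ α κ)

    sharesColourOfX-≗ : ∀ u → sharesColourOfX u Preserves _≗_ ⟶ _≡_
    sharesColourOfX-≗ u {κ} {κ′} κ≗κ′ = cong₂ _*_
      (𝟙-cong (mk⇔ (Proper-≗ κ≗κ′) (Proper-≗ (sym ∘ κ≗κ′)) ×-⇔
               mk⇔ (λ e → trans (sym (κ≗κ′ u)) (trans e (κ≗κ′ x)))
                   (λ e → trans (κ≗κ′ u) (trans e (sym (κ≗κ′ x)))))
              (proper? H[ K ] κ ×-dec κ u ≟ κ x) (proper? H[ K ] κ′ ×-dec κ′ u ≟ κ′ x))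
      (cong ind (hasTypeᵇ-≗ α κ≗κ′))

    sharesColourOfX-transpose : ∀ {u w} → u ∈ K → w ∈ K → ∀ κ →
                                sharesColourOfX w (κ ∘ (transpose u w ⟨$⟩ʳ_)) ≡ sharesColourOfX u κ
    sharesColourOfX-transpose {u} {w} u∈K w∈K κ = cong₂ _*_
      (𝟙-cong (Proper-automorphism {G = H[ K ]} {π = transpose u w} (transpose-H[K] u∈K w∈K) κ ×-⇔
               mk⇔ (λ e → trans (sym κτw≡κu) (trans e κτx≡κx)) (λ e → trans κτw≡κu (trans e (sym κτx≡κx))))
              (proper? H[ K ] (κ ∘ τ) ×-dec κ (τ w) ≟ κ (τ x)) (proper? H[ K ] κ ×-dec κ u ≟ κ x))
      (cong ind (hasTypeᵇ-permute α (transpose u w) κ))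
      where
      τ : Fin n → Fin n
      τ = PC.transpose u w
      κτw≡κu : κ (τ w) ≡ κ u
      κτw≡κu = cong κ (transpose-matchʳ u w)
      κτx≡κx : κ (τ x) ≡ κ x
      κτx≡κx = cong κ (transpose-fixed (∈K⇒≢x u∈K ∘ sym) (∈K⇒≢x w∈K ∘ sym))

    sharedColourCount : Fin n → ℕ
    sharedColourCount u = ∑ (allFuns n m) (sharesColourOfX u)

    sharedColourCount-constant : ∀ {u w} → u ∈ K → w ∈ K → sharedColourCount w ≡ sharedColourCount u
    sharedColourCount-constant {u} {w} u∈K w∈K =
      trans (sym (∑-allFuns-permute (transpose u w) (sharesColourOfX w) (sharesColourOfX-≗ w)))
            (∑-cong (allFuns n m) (sharesColourOfX-transpose u∈K w∈K))

    chromCoeff-H[_] : ∀ S → S ⊆ K →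
      chromCoeff H[ S ] m α ≡ chromCoeff H[ ⊥ ] m α + ∑ (allFin n) (λ u → 𝟙 (u ∈? S) * sharedColourCount u)
    chromCoeff-H[ S ] S⊆K = begin
      chromCoeff H[ S ] m α
        ≡⟨ chromCoeff-∑ H[ S ] m α ⟩
      ∑ F (λ κ → 𝟙 (proper? H[ S ] κ) * t κ)
        ≡⟨ ∑-cong F (λ κ → cong (_* t κ) (𝟙-proper-H[ S ] S⊆K κ)) ⟩
      ∑ F (λ κ → (𝟙 (proper? H[ ⊥ ] κ) + ∑ V (λ u → 𝟙 (u ∈? S) * e u κ)) * t κ)
        ≡⟨ ∑-cong F (λ κ → *-distribʳ-+ (t κ) (𝟙 (proper? H[ ⊥ ] κ)) (∑ V (λ u → 𝟙 (u ∈? S) * e u κ))) ⟩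
      ∑ F (λ κ → 𝟙 (proper? H[ ⊥ ] κ) * t κ + ∑ V (λ u → 𝟙 (u ∈? S) * e u κ) * t κ)
        ≡⟨ ∑-+ F _ _ ⟩
      ∑ F (λ κ → 𝟙 (proper? H[ ⊥ ] κ) * t κ) + ∑ F (λ κ → ∑ V (λ u → 𝟙 (u ∈? S) * e u κ) * t κ)
        ≡⟨ cong₂ _+_ (sym (chromCoeff-∑ H[ ⊥ ] m α)) (∑-cong F (λ κ → sym (∑-*ʳ V (t κ) _))) ⟩
      chromCoeff H[ ⊥ ] m α + ∑ F (λ κ → ∑ V (λ u → 𝟙 (u ∈? S) * e u κ * t κ))
        ≡⟨ cong (chromCoeff H[ ⊥ ] m α +_) (∑-comm F V _) ⟩
      chromCoeff H[ ⊥ ] m α + ∑ V (λ u → ∑ F (λ κ → 𝟙 (u ∈? S) * e u κ * t κ))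
        ≡⟨ cong (chromCoeff H[ ⊥ ] m α +_) (∑-cong V (λ u →
             trans (∑-cong F (λ κ → *-assoc (𝟙 (u ∈? S)) (e u κ) (t κ)))
                   (∑-*ˡ F (𝟙 (u ∈? S)) (sharesColourOfX u)))) ⟩
      chromCoeff H[ ⊥ ] m α + ∑ V (λ u → 𝟙 (u ∈? S) * sharedColourCount u) ∎
      where
      open ≡-Reasoning
      F : List (Fin n → Fin m)
      F = allFuns n m
      V : List (Fin n)
      V = allFin n
      t : (Fin n → Fin m) → ℕ
      t κ = ind (hasTypeᵇ α κ)
      e : Fin n → (Fin n → Fin m) → ℕ
      e u κ = 𝟙 (proper? H[ K ] κ ×-dec κ u ≟ κ x)

    chromCoeff-affine : ∃[ d ] ∀ S → S ⊆ K → chromCoeff H[ S ] m α ≡ chromCoeff H[ ⊥ ] m α + ∣ S ∣ * d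
    chromCoeff-affine with nonempty? K
    ... | yes (w , w∈K) = sharedColourCount w , λ S S⊆K → trans (chromCoeff-H[ S ] S⊆K) (cong (_ +_)
      (∑-subset-const S sharedColourCount _ (λ u u∈S → sharedColourCount-constant w∈K (S⊆K u∈S))))
    ... | no K-empty = 0 , λ S S⊆K → trans (chromCoeff-H[ S ] S⊆K) (cong (_ +_)
      (∑-subset-const S sharedColourCount 0 (λ u u∈S → ⊥-elim (K-empty (u , S⊆K u∈S)))))

open import Data.Integer using (ℤ; +_; _+_; _-_; _*_)
import Data.Integer.Properties as ℤ
open import Data.Integer.Tactic.RingSolver using (solve-∀)

three-term-identity : ∀ (a b c x y : ℤ) →
  (a - b) * (x + c * y) + (b - c) * (x + a * y) + (c - a) * (x + b * y) ≡ + 0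
three-term-identity = solve-∀

affine-three-term : ∀ c d i j k {Cᵢ Cⱼ Cₖ : ℕ} →
  Cᵢ ≡ c ℕ.+ i ℕ.* d → Cⱼ ≡ c ℕ.+ j ℕ.* d → Cₖ ≡ c ℕ.+ k ℕ.* d →
  (+ i - + j) * + Cₖ + (+ j - + k) * + Cᵢ + (+ k - + i) * + Cⱼ ≡ + 0
affine-three-term c d i j k refl refl refl =
  trans (cong₂ _+_ (cong₂ _+_ (cong ((+ i - + j) *_) (pos k)) (cong ((+ j - + k) *_) (pos i)))
                   (cong ((+ k - + i) *_) (pos j)))
        (three-term-identity (+ i) (+ j) (+ k) (+ c) (+ d))
  where
  pos : ∀ a → + (c ℕ.+ a ℕ.* d) ≡ + c + + a * + d
  pos a = trans (ℤ.pos-+ c (a ℕ.* d)) (cong (λ z → + c + z) (ℤ.pos-* a d))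

corollary2p4 : (n : ℕ) (H : Graph n)
    → (∀ u v → H u v ≡ H v u)
    → (∀ v → H v v ≡ false)
    → (K : Subset n)
    → (∀ u v → u ∈ K → v ∈ K → u ≢ v → H u v ≡ true)
    → (x : Fin n) → x ∉ K
    → (∀ v → v ∈ K → H x v ≡ true)
    → (∀ u v → u ∈ K → v ∈ K → ∀ w → w ≢ x
         → ((w ≡ u ⊎ H u w ≡ true) ⇔ (w ≡ v ⊎ H v w ≡ true)))
    → (i j k : ℕ) → i ≤ j → j ≤ k → k ≤ ∣ K ∣
    → (Si Sj Sk : Subset n)
    → Si ⊆ K → ∣ Si ∣ ≡ i
    → Sj ⊆ K → ∣ Sj ∣ ≡ j
    → Sk ⊆ K → ∣ Sk ∣ ≡ k
    → (m : ℕ) (α : Fin m → ℕ)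
    → (+ i - + j) * + chromCoeff (removeEdgesTo H x Sk) m α
      + (+ j - + k) * + chromCoeff (removeEdgesTo H x Si) m α
      + (+ k - + i) * + chromCoeff (removeEdgesTo H x Sj) m α
      ≡ + 0
corollary2p4 n H H-sym H-irr K K-clique x x∉K x-joined K-twins i j k _ _ _
             Si Sj Sk Si⊆K ∣Si∣≡i Sj⊆K ∣Sj∣≡j Sk⊆K ∣Sk∣≡k m α =
  affine-three-term (chromCoeff H[ ⊥ ] m α) d i j k (at Si⊆K ∣Si∣≡i) (at Sj⊆K ∣Sj∣≡j) (at Sk⊆K ∣Sk∣≡k)
  where
  open CliqueJoin H H-sym H-irr K K-clique x x∉K x-joined K-twins using (H[_]; chromCoeff-affine)
  d : ℕ
  d = proj₁ (chromCoeff-affine m α)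
  at : ∀ {S s} → S ⊆ K → ∣ S ∣ ≡ s → chromCoeff H[ S ] m α ≡ chromCoeff H[ ⊥ ] m α ℕ.+ s ℕ.* d
  at {S} S⊆K refl = proj₂ (chromCoeff-affine m α) S S⊆K
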